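{- $a(n) = 2^{n}\left(1-\mathcal{O}(n^{ -1})\right)$ as $n\to\infty$; in particular $a(n)=2^n(1-o(1))$.
   Context: $\mu$ is the morphism on binary words defined by $\mu(0)=01$, $\mu(1)=10$, and $\mu^n$ is its $n$-fold iterate. $a(n)$ denotes the length of a longest common subsequence of $\mu^n(0)$ and $\mu^n(1)$. -}

module Defs where

open import Data.Bool using (Bool; true; false)
open import Data.Nat using (ℕ; zero; suc; _≤_)
open import Data.List using (List; []; _∷_; length; concatMap)
open import Data.List.Relation.Binary.Sublist.Propositional using (_⊆_)
open import Relation.Binary.PropositionalEquality using (_≡_)
open import Data.Product using (Σ; _×_; _,_)

-- Binary letters: false = 0, true = 1.
Word : Set
Word = List Bool

μ₁ : Bool → Word
μ₁ false = false ∷ true ∷ []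
μ₁ true  = true ∷ false ∷ []

μ : Word → Word
μ = concatMap μ₁

μ^ : ℕ → Word → Word
μ^ zero    w = w
μ^ (suc n) w = μ (μ^ n w)

CommonSubseq : Word → Word → Word → Set
CommonSubseq u w v = (u ⊆ w) × (u ⊆ v)

IsLCSLength : Word → Word → ℕ → Set
IsLCSLength w v k =
  (Σ Word λ u → CommonSubseq u w v × length u ≡ k) × ((u : Word) → CommonSubseq u w v → length u ≤ k)

module Submission where

-- Write t n = μ^n(0) and s n = μ^n(1); both have length 2^n, and
-- t (n+1) = t n · s n, s (n+1) = s n · t n.  We show that some common
-- subsequence of t n and s n misses at most 16·2^n / n letters.
--
-- Fix a level k and a common
-- subsequence c₀ of t k, s k of length ℓ.  For m = j + k + 1 both t m and s m
-- are concatenations of 2^(j+1) blocks from {t k, s k}.  Align t m with s m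
-- shifted by one block: of the 2^(j+1) − 1 aligned block pairs, 2^j are equal
-- (contributing 2^k letters) and the others contribute ℓ letters via c₀; so
-- t m and s m share a subsequence of length ≥ 2^j(2^k + ℓ) − ℓ.
--
-- If c₀ misses E letters of t k, the aligned word
-- misses at most 2^j·E + 2^k letters of t m.  Taking j ≈ m/4 and k ≈ 3m/4,
-- the bound k·E ≤ 16·2^k propagates to m, so strong induction gives it for
-- all n.

open import Defs
open import Data.Bool using (Bool; true; false)
open import Data.Bool.Properties using (_≟_)
open import Data.List using ([]; _∷_; length; _++_)
open import Data.List.Properties using (length-++; concatMap-++; ++-assoc)
open import Data.List.Relation.Binary.Sublist.Propositional using (_⊆_; _∷_; _∷ʳ_; ⊆-refl)
open import Data.List.Relation.Binary.Sublist.Propositional.Properties using (length-mono-≤; []⊆-universal; ++⁺; ++⁺ˡ; ++⁺ʳ)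
open import Data.Nat using (ℕ; zero; suc; _≤_; _<_; _⊔_; _+_; _*_; _^_; _∸_; z≤n; s≤s; s≤s⁻¹)
open import Data.Nat.Properties hiding (_≟_)
open import Data.Nat.DivMod using (_/_; _%_; m≡m%n+[m/n]*n; m%n<n)
open import Data.Nat.Induction using (<-rec)
open import Data.Nat.Tactic.RingSolver using (solve-∀)
open import Data.Product using (Σ; ∃-syntax; _×_; _,_; proj₁; proj₂)
open import Data.Sum using (_⊎_; inj₁; inj₂)
open import Relation.Binary.PropositionalEquality
open import Relation.Nullary using (Dec; yes; no)
open import Data.Empty using (⊥-elim)

matchFirst : {x y : Bool} → Dec (x ≡ y) → ℕ → ℕ
matchFirst (yes _) m = suc m
matchFirst (no _)  _ = 0

lcs : Word → Word → ℕ
lcs []      _       = 0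
lcs (_ ∷ _) []      = 0
lcs (x ∷ w) (y ∷ v) = (lcs w (y ∷ v) ⊔ lcs (x ∷ w) v) ⊔ matchFirst (x ≟ y) (lcs w v)

lcs-maximal : {u w v : Word} → u ⊆ w → u ⊆ v → length u ≤ lcs w v
lcs-maximal {[]} _ _ = z≤n
lcs-maximal {_ ∷ _} {x ∷ w} {y ∷ v} (.x ∷ʳ p) q =
  ≤-trans (lcs-maximal p q) (≤-trans (m≤m⊔n _ (lcs (x ∷ w) v)) (m≤m⊔n _ _))
lcs-maximal {_ ∷ _} {x ∷ w} {y ∷ v} (e ∷ p) (.y ∷ʳ q) =
  ≤-trans (lcs-maximal (e ∷ p) q) (≤-trans (m≤n⊔m (lcs w (y ∷ v)) _) (m≤m⊔n _ _))
lcs-maximal {_ ∷ _} {x ∷ w} {y ∷ v} (e₁ ∷ p) (e₂ ∷ q) with x ≟ y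
... | yes _  = ≤-trans (s≤s (lcs-maximal p q)) (m≤n⊔m _ _)
... | no x≢y = ⊥-elim (x≢y (trans (sym e₁) e₂))

HasCommonOfLength : Word → Word → ℕ → Set
HasCommonOfLength w v m = Σ Word λ u → CommonSubseq u w v × length u ≡ m

has-common-⊔ : {w v : Word} (a b : ℕ) →
               HasCommonOfLength w v a → HasCommonOfLength w v b → HasCommonOfLength w v (a ⊔ b)
has-common-⊔ {w} {v} a b ha hb with ⊔-sel a b
... | inj₁ a⊔b≡a = subst (HasCommonOfLength w v) (sym a⊔b≡a) ha
... | inj₂ a⊔b≡b = subst (HasCommonOfLength w v) (sym a⊔b≡b) hb

lcs-attained : (w v : Word) → HasCommonOfLength w v (lcs w v)
lcs-attained []      v       = [] , ([]⊆-universal [] , []⊆-universal v) , refl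
lcs-attained (x ∷ w) []      = [] , ([]⊆-universal _ , []⊆-universal []) , refl
lcs-attained (x ∷ w) (y ∷ v) =
  has-common-⊔ _ _
    (has-common-⊔ _ _ (skip-x (lcs-attained w (y ∷ v))) (skip-y (lcs-attained (x ∷ w) v)))
    (match (x ≟ y) (lcs-attained w v))
  where
  skip-x : {m : ℕ} → HasCommonOfLength w (y ∷ v) m → HasCommonOfLength (x ∷ w) (y ∷ v) m
  skip-x (u , (uw , uv) , eq) = u , (x ∷ʳ uw , uv) , eq
  skip-y : {m : ℕ} → HasCommonOfLength (x ∷ w) v m → HasCommonOfLength (x ∷ w) (y ∷ v) m
  skip-y (u , (uw , uv) , eq) = u , (uw , y ∷ʳ uv) , eq
  match : {m : ℕ} (d : Dec (x ≡ y)) → HasCommonOfLength w v m →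
          HasCommonOfLength (x ∷ w) (y ∷ v) (matchFirst d m)
  match (yes x≡y) (u , (uw , uv) , eq) = x ∷ u , (refl ∷ uw , x≡y ∷ uv) , cong suc eq
  match (no _)    _                    = [] , ([]⊆-universal _ , []⊆-universal _) , refl

lcs-isLCS : (w v : Word) → IsLCSLength w v (lcs w v)
lcs-isLCS w v = lcs-attained w v , λ u common → lcs-maximal (proj₁ common) (proj₂ common)


μ-++ : (a b : Word) → μ (a ++ b) ≡ μ a ++ μ b
μ-++ = concatMap-++ μ₁

μ^-++ : (n : ℕ) (a b : Word) → μ^ n (a ++ b) ≡ μ^ n a ++ μ^ n b
μ^-++ zero    a b = refl
μ^-++ (suc n) a b = trans (cong μ (μ^-++ n a b)) (μ-++ (μ^ n a) (μ^ n b))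

μ^-suc : (n : ℕ) (w : Word) → μ^ (suc n) w ≡ μ^ n (μ w)
μ^-suc zero    w = refl
μ^-suc (suc n) w = cong μ (μ^-suc n w)

length-μ : (w : Word) → length (μ w) ≡ 2 * length w
length-μ []          = refl
length-μ (false ∷ w) = trans (cong (2 +_) (length-μ w)) (sym (*-distribˡ-+ 2 1 (length w)))
length-μ (true ∷ w)  = trans (cong (2 +_) (length-μ w)) (sym (*-distribˡ-+ 2 1 (length w)))

length-μ^ : (n : ℕ) (w : Word) → length (μ^ n w) ≡ 2 ^ n * length w
length-μ^ zero    w = sym (*-identityˡ (length w))
length-μ^ (suc n) w = begin
  length (μ (μ^ n w))       ≡⟨ length-μ (μ^ n w) ⟩
  2 * length (μ^ n w)       ≡⟨ cong (2 *_) (length-μ^ n w) ⟩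
  2 * (2 ^ n * length w)    ≡⟨ sym (*-assoc 2 (2 ^ n) (length w)) ⟩
  2 ^ suc n * length w      ∎
  where open ≡-Reasoning

t s : ℕ → Word
t n = μ^ n (false ∷ [])
s n = μ^ n (true ∷ [])

t-suc : (n : ℕ) → t (suc n) ≡ t n ++ s n
t-suc n = trans (μ^-suc n (false ∷ [])) (μ^-++ n (false ∷ []) (true ∷ []))

s-suc : (n : ℕ) → s (suc n) ≡ s n ++ t n
s-suc n = trans (μ^-suc n (true ∷ [])) (μ^-++ n (true ∷ []) (false ∷ []))

length-t : (n : ℕ) → length (t n) ≡ 2 ^ n
length-t n = trans (length-μ^ n (false ∷ [])) (*-identityʳ (2 ^ n))

length-s : (n : ℕ) → length (s n) ≡ 2 ^ n
length-s n = trans (length-μ^ n (true ∷ [])) (*-identityʳ (2 ^ n))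


-- The bounds for the two aligned halves, plus ℓ letters from the newly
-- aligned block pair in the middle, give the bound one level up.
doubling-bound : (x m₁ m₂ m ℓ : ℕ) → x ≤ m₁ + ℓ → x ≤ m₂ + ℓ → ℓ ≤ m →
                 2 * x ≤ (m₁ + (m + m₂)) + ℓ
doubling-bound x m₁ m₂ m ℓ h₁ h₂ h = begin
  2 * x                      ≡⟨ cong (x +_) (+-identityʳ x) ⟩
  x + x                      ≤⟨ +-mono-≤ h₁ h₂ ⟩
  (m₁ + ℓ) + (m₂ + ℓ)        ≤⟨ +-monoʳ-≤ (m₁ + ℓ) (+-monoʳ-≤ m₂ h) ⟩
  (m₁ + ℓ) + (m₂ + m)        ≡⟨ regroup m₁ m₂ m ℓ ⟩
  (m₁ + (m + m₂)) + ℓ        ∎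
  where
  open ≤-Reasoning
  regroup : (m₁ m₂ m ℓ : ℕ) → (m₁ + ℓ) + (m₂ + m) ≡ (m₁ + (m + m₂)) + ℓ
  regroup = solve-∀

++-regroup : (a b c d : Word) → (a ++ b) ++ (c ++ d) ≡ (a ++ (b ++ c)) ++ d
++-regroup a b c d = begin
  (a ++ b) ++ (c ++ d)     ≡⟨ ++-assoc a b (c ++ d) ⟩
  a ++ (b ++ (c ++ d))     ≡⟨ cong (a ++_) (sym (++-assoc b c d)) ⟩
  a ++ ((b ++ c) ++ d)     ≡⟨ sym (++-assoc a (b ++ c) d) ⟩
  (a ++ (b ++ c)) ++ d     ∎
  where open ≡-Reasoning

module BlockAlignment (k : ℕ) (c₀ : Word) (c₀-common : CommonSubseq c₀ (t k) (s k)) where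

  ℓ : ℕ
  ℓ = length c₀

  Block : Word → Set
  Block w = w ≡ t k ⊎ w ≡ s k

  length-block : {w : Word} → Block w → length w ≡ 2 ^ k
  length-block (inj₁ refl) = length-t k
  length-block (inj₂ refl) = length-s k

  ℓ≤2^k : ℓ ≤ 2 ^ k
  ℓ≤2^k = ≤-trans (length-mono-≤ (proj₁ c₀-common)) (≤-reflexive (length-t k))

  block-common : {f g : Word} → Block f → Block g → Σ Word λ L → CommonSubseq L f g × ℓ ≤ length L
  block-common (inj₁ refl) (inj₁ refl) = t k , (⊆-refl , ⊆-refl) , ≤-trans ℓ≤2^k (≤-reflexive (sym (length-t k)))
  block-common (inj₂ refl) (inj₂ refl) = s k , (⊆-refl , ⊆-refl) , ≤-trans ℓ≤2^k (≤-reflexive (sym (length-s k)))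
  block-common (inj₁ refl) (inj₂ refl) = c₀ , c₀-common , ≤-refl
  block-common (inj₂ refl) (inj₁ refl) = c₀ , (proj₂ c₀-common , proj₁ c₀-common) , ≤-refl

  record Shifted (X Y : Word) (j : ℕ) : Set where
    field
      head-X rest-X rest-Y last-Y common : Word
      head-block : Block head-X
      last-block : Block last-Y
      split-X    : X ≡ head-X ++ rest-X
      split-Y    : Y ≡ rest-Y ++ last-Y
      common-sub : CommonSubseq common rest-X rest-Y
      long       : 2 ^ j * (2 ^ k + ℓ) ≤ length common + ℓ

  -- Base case: in f·g against g·f the middle blocks g are aligned.
  shifted-pair : {f g : Word} → Block f → Block g → Shifted (f ++ g) (g ++ f) 0
  shifted-pair {f} {g} bf bg = record
    { head-X = f ; rest-X = g ; rest-Y = g ; last-Y = f ; common = g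
    ; head-block = bf ; last-block = bf ; split-X = refl ; split-Y = refl
    ; common-sub = ⊆-refl , ⊆-refl
    ; long = ≤-reflexive (trans (*-identityˡ _) (cong (_+ ℓ) (sym (length-block bg)))) }

  -- Concatenation doubles the alignment: the head block of X₂ is matched
  -- against the last block of Y₁.
  shifted-++ : {X₁ Y₁ X₂ Y₂ : Word} {j : ℕ} →
               Shifted X₁ Y₁ j → Shifted X₂ Y₂ j → Shifted (X₁ ++ X₂) (Y₁ ++ Y₂) (suc j)
  shifted-++ {j = j} S₁ S₂ = record
    { head-X = S₁.head-X ; rest-X = S₁.rest-X ++ (S₂.head-X ++ S₂.rest-X)
    ; rest-Y = S₁.rest-Y ++ (S₁.last-Y ++ S₂.rest-Y) ; last-Y = S₂.last-Y
    ; common = S₁.common ++ (L ++ S₂.common)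
    ; head-block = S₁.head-block ; last-block = S₂.last-block
    ; split-X = trans (cong₂ _++_ S₁.split-X S₂.split-X)
                      (++-assoc S₁.head-X S₁.rest-X (S₂.head-X ++ S₂.rest-X))
    ; split-Y = trans (cong₂ _++_ S₁.split-Y S₂.split-Y)
                      (++-regroup S₁.rest-Y S₁.last-Y S₂.rest-Y S₂.last-Y)
    ; common-sub = ++⁺ (proj₁ S₁.common-sub) (++⁺ (proj₁ L-common) (proj₁ S₂.common-sub))
                 , ++⁺ (proj₂ S₁.common-sub) (++⁺ (proj₂ L-common) (proj₂ S₂.common-sub))
    ; long = begin
        2 ^ suc j * (2 ^ k + ℓ)
          ≡⟨ *-assoc 2 (2 ^ j) (2 ^ k + ℓ) ⟩
        2 * (2 ^ j * (2 ^ k + ℓ))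
          ≤⟨ doubling-bound _ (length S₁.common) (length S₂.common) (length L) ℓ S₁.long S₂.long ℓ≤L ⟩
        (length S₁.common + (length L + length S₂.common)) + ℓ
          ≡⟨ cong (_+ ℓ) (sym (trans (length-++ S₁.common) (cong (length S₁.common +_) (length-++ L)))) ⟩
        length (S₁.common ++ (L ++ S₂.common)) + ℓ ∎
    }
    where
    module S₁ = Shifted S₁
    module S₂ = Shifted S₂
    open ≤-Reasoning
    middle : Σ Word λ L → CommonSubseq L S₂.head-X S₁.last-Y × ℓ ≤ length L
    middle = block-common S₂.head-block S₁.last-block
    L : Word
    L = proj₁ middle
    L-common : CommonSubseq L S₂.head-X S₁.last-Y
    L-common = proj₁ (proj₂ middle)
    ℓ≤L : ℓ ≤ length L
    ℓ≤L = proj₂ (proj₂ middle)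

  shifted-tower : (j : ℕ) → Shifted (t (j + suc k)) (s (j + suc k)) j × Shifted (s (j + suc k)) (t (j + suc k)) j
  shifted-tower zero =
    subst₂ (λ X Y → Shifted X Y 0) (sym (t-suc k)) (sym (s-suc k)) (shifted-pair (inj₁ refl) (inj₂ refl)) ,
    subst₂ (λ X Y → Shifted X Y 0) (sym (s-suc k)) (sym (t-suc k)) (shifted-pair (inj₂ refl) (inj₁ refl))
  shifted-tower (suc j) with shifted-tower j
  ... | ts , st =
    subst₂ (λ X Y → Shifted X Y (suc j)) (sym (t-suc m)) (sym (s-suc m)) (shifted-++ ts st) ,
    subst₂ (λ X Y → Shifted X Y (suc j)) (sym (s-suc m)) (sym (t-suc m)) (shifted-++ st ts)
    where
    m : ℕ
    m = j + suc k

  block-alignment : (j : ℕ) → Σ Word λ c →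
                    CommonSubseq c (t (j + suc k)) (s (j + suc k)) × 2 ^ j * (2 ^ k + ℓ) ≤ length c + ℓ
  block-alignment j =
    common , (subst (common ⊆_) (sym split-X) (++⁺ˡ head-X (proj₁ common-sub)) ,
              subst (common ⊆_) (sym split-Y) (++⁺ʳ last-Y (proj₂ common-sub))) , long
    where open Shifted (proj₁ (shifted-tower j))

open BlockAlignment using (block-alignment)

record NearlyCommon (C n : ℕ) : Set where
  field
    word         : Word
    word-common  : CommonSubseq word (t n) (s n)
    defect       : ℕ
    covers       : 2 ^ n ≤ length word + defect
    defect-bound : n * defect ≤ C * 2 ^ n

nearly-common-small : (C n : ℕ) → n ≤ C → NearlyCommon C n
nearly-common-small C n n≤C = record
  { word = [] ; word-common = []⊆-universal _ , []⊆-universal _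
  ; defect = 2 ^ n ; covers = ≤-refl ; defect-bound = *-monoˡ-≤ (2 ^ n) n≤C }

-- Block alignment in terms of defects: if c₀ misses at most E of the P = 2^k
-- letters, the aligned word misses at most x·E + P of the x·2P letters (x = 2^j).
aligned-defect : (x P ℓ E m : ℕ) → ℓ ≤ P → P ≤ ℓ + E → x * (P + ℓ) ≤ m + ℓ →
                 x * (2 * P) ≤ m + (x * E + P)
aligned-defect x P ℓ E m ℓ≤P P≤ℓ+E aligned = begin
  x * (2 * P)              ≡⟨ expand x P ⟩
  x * P + x * P            ≤⟨ +-monoʳ-≤ (x * P) (*-monoʳ-≤ x P≤ℓ+E) ⟩
  x * P + x * (ℓ + E)      ≡⟨ collect x P ℓ E ⟩
  x * (P + ℓ) + x * E      ≤⟨ +-monoˡ-≤ (x * E) aligned ⟩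
  (m + ℓ) + x * E          ≤⟨ +-monoˡ-≤ (x * E) (+-monoʳ-≤ m ℓ≤P) ⟩
  (m + P) + x * E          ≡⟨ reorder m P (x * E) ⟩
  m + (x * E + P)          ∎
  where
  open ≤-Reasoning
  expand : (x P : ℕ) → x * (2 * P) ≡ x * P + x * P
  expand = solve-∀
  collect : (x P ℓ E : ℕ) → x * P + x * (ℓ + E) ≡ x * (P + ℓ) + x * E
  collect = solve-∀
  reorder : (m P y : ℕ) → (m + P) + y ≡ m + (y + P)
  reorder = solve-∀

-- The defect recursion keeps n·defect ≤ C·2^n when n is at most 4/3 of the
-- old level k and 3n ≤ 2C·x (x = 2^j, y = 2^k, so 2^n = x·2y).
defect-recursion : (C x y n k E : ℕ) → 3 * n ≤ 4 * k → 3 * n ≤ 2 * C * x → k * E ≤ C * y →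
                   n * (x * E + y) ≤ C * (x * (2 * y))
defect-recursion C x y n k E n≤4k/3 n≤2Cx/3 kE≤Cy = *-cancelˡ-≤ 3 (begin
  3 * (n * (x * E + y))              ≡⟨ expand n x y E ⟩
  x * ((3 * n) * E) + (3 * n) * y    ≤⟨ +-mono-≤ (*-monoʳ-≤ x (*-monoˡ-≤ E n≤4k/3)) (*-monoˡ-≤ y n≤2Cx/3) ⟩
  x * ((4 * k) * E) + (2 * C * x) * y ≡⟨ cong (_+ 2 * C * x * y) (regroup x k E) ⟩
  4 * x * (k * E) + 2 * C * x * y    ≤⟨ +-monoˡ-≤ (2 * C * x * y) (*-monoʳ-≤ (4 * x) kE≤Cy) ⟩
  4 * x * (C * y) + 2 * C * x * y    ≡⟨ total C x y ⟩
  3 * (C * (x * (2 * y)))            ∎)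
  where
  open ≤-Reasoning
  expand : (n x y E : ℕ) → 3 * (n * (x * E + y)) ≡ x * ((3 * n) * E) + (3 * n) * y
  expand = solve-∀
  regroup : (x k E : ℕ) → x * ((4 * k) * E) ≡ 4 * x * (k * E)
  regroup = solve-∀
  total : (C x y : ℕ) → 4 * x * (C * y) + 2 * C * x * y ≡ 3 * (C * (x * (2 * y)))
  total = solve-∀

nearly-common-extend : (j k : ℕ) → 3 * (j + suc k) ≤ 4 * k → 3 * (j + suc k) ≤ 32 * 2 ^ j →
                       NearlyCommon 16 k → NearlyCommon 16 (j + suc k)
nearly-common-extend j k n≤4k/3 n≤32x/3 nc = record
  { word = c ; word-common = c-common ; defect = 2 ^ j * defect + 2 ^ k
  ; covers = subst (_≤ length c + (2 ^ j * defect + 2 ^ k)) (sym 2^n≡)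
      (aligned-defect (2 ^ j) (2 ^ k) (length word) defect (length c) ℓ≤2^k covers aligned)
  ; defect-bound = subst (λ z → (j + suc k) * (2 ^ j * defect + 2 ^ k) ≤ 16 * z) (sym 2^n≡)
      (defect-recursion 16 (2 ^ j) (2 ^ k) (j + suc k) k defect n≤4k/3 n≤32x/3 defect-bound) }
  where
  open NearlyCommon nc
  alignment : Σ Word λ c → CommonSubseq c (t (j + suc k)) (s (j + suc k)) ×
              2 ^ j * (2 ^ k + length word) ≤ length c + length word
  alignment = block-alignment k word word-common j
  c : Word
  c = proj₁ alignment
  c-common : CommonSubseq c (t (j + suc k)) (s (j + suc k))
  c-common = proj₁ (proj₂ alignment)
  aligned : 2 ^ j * (2 ^ k + length word) ≤ length c + length word
  aligned = proj₂ (proj₂ alignment)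
  ℓ≤2^k : length word ≤ 2 ^ k
  ℓ≤2^k = BlockAlignment.ℓ≤2^k k word word-common
  2^n≡ : 2 ^ (j + suc k) ≡ 2 ^ j * (2 * 2 ^ k)
  2^n≡ = ^-distribˡ-+-* 2 j (suc k)

suc≤2^ : (j : ℕ) → suc j ≤ 2 ^ j
suc≤2^ zero    = ≤-refl
suc≤2^ (suc j) = +-mono-≤ (m^n>0 2 j) (≤-trans (suc≤2^ j) (≤-reflexive (sym (+-identityʳ (2 ^ j)))))

-- Every n ≥ 4 splits as n = j + 1 + k with k ≥ 3n/4 and 3n ≤ 32·2^j,
-- namely j = ⌊n/4⌋ − 1 and k = r + 3⌊n/4⌋ where r = n mod 4.
split-level : (n : ℕ) → n < 4 ⊎
              Σ ℕ λ j → Σ ℕ λ k → n ≡ j + suc k × 3 * n ≤ 4 * k × 3 * n ≤ 32 * 2 ^ j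
split-level n with n / 4 | m≡m%n+[m/n]*n n 4 | m%n<n n 4
... | zero  | n≡r   | r<4 = inj₁ (subst (_< 4) (sym (trans n≡r (+-identityʳ (n % 4)))) r<4)
... | suc j | n≡r+4 | r<4 = inj₂ (j , r + 3 * suc j , n≡ , n≤4k/3 , n≤32x/3)
  where
  r : ℕ
  r = n % 4
  open ≤-Reasoning
  n≡ : n ≡ j + suc (r + 3 * suc j)
  n≡ = trans n≡r+4 (split r j)
    where
    split : (r j : ℕ) → r + suc j * 4 ≡ j + suc (r + 3 * suc j)
    split = solve-∀
  3n≡ : 3 * n ≡ 3 * r + 12 * suc j
  3n≡ = trans (cong (3 *_) n≡r+4) (expand r j)
    where
    expand : (r j : ℕ) → 3 * (r + suc j * 4) ≡ 3 * r + 12 * (1 + j)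
    expand = solve-∀
  n≤4k/3 : 3 * n ≤ 4 * (r + 3 * suc j)
  n≤4k/3 = begin
    3 * n                       ≡⟨ 3n≡ ⟩
    3 * r + 12 * suc j          ≤⟨ +-monoˡ-≤ (12 * suc j) (*-monoˡ-≤ r (m≤m+n 3 1)) ⟩
    4 * r + 12 * suc j          ≡⟨ expand r j ⟩
    4 * (r + 3 * suc j)         ∎
    where
    expand : (r j : ℕ) → 4 * r + 12 * (1 + j) ≡ 4 * (r + 3 * (1 + j))
    expand = solve-∀
  n≤32x/3 : 3 * n ≤ 32 * 2 ^ j
  n≤32x/3 = begin
    3 * n                       ≡⟨ 3n≡ ⟩
    3 * r + 12 * suc j          ≤⟨ +-mono-≤ (*-monoʳ-≤ 3 (s≤s⁻¹ r<4)) (*-monoʳ-≤ 12 (suc≤2^ j)) ⟩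
    9 + 12 * 2 ^ j              ≤⟨ +-mono-≤ (≤-trans (m≤m+n 9 11) (*-monoʳ-≤ 20 (m^n>0 2 j))) ≤-refl ⟩
    20 * 2 ^ j + 12 * 2 ^ j     ≡⟨ sym (*-distribʳ-+ (2 ^ j) 20 12) ⟩
    32 * 2 ^ j                  ∎

nearly-common : (n : ℕ) → NearlyCommon 16 n
nearly-common = <-rec (NearlyCommon 16) step
  where
  step : (n : ℕ) → ({m : ℕ} → m < n → NearlyCommon 16 m) → NearlyCommon 16 n
  step n ih with split-level n
  ... | inj₁ n<4 = nearly-common-small 16 n (≤-trans (<⇒≤ n<4) (m≤m+n 4 12))
  ... | inj₂ (j , k , refl , n≤4k/3 , n≤32x/3) =
    nearly-common-extend j k n≤4k/3 n≤32x/3 (ih (m≤n+m (suc k) j))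

lcs-defect : {C n : ℕ} → NearlyCommon C n → n * (2 ^ n ∸ lcs (t n) (s n)) ≤ C * 2 ^ n
lcs-defect {C} {n} nc = ≤-trans (*-monoʳ-≤ n lcs-defect≤defect) defect-bound
  where
  open NearlyCommon nc
  lcs-defect≤defect : 2 ^ n ∸ lcs (t n) (s n) ≤ defect
  lcs-defect≤defect = ≤-trans (∸-monoʳ-≤ (2 ^ n) (lcs-maximal (proj₁ word-common) (proj₂ word-common)))
                              (m≤n+o⇒m∸n≤o (2 ^ n) (length word) covers)

lcs≤2^n : (n : ℕ) → lcs (t n) (s n) ≤ 2 ^ n
lcs≤2^n n with lcs-attained (t n) (s n)
... | u , (u⊆t , _) , length-u≡lcs =
  ≤-trans (≤-reflexive (sym length-u≡lcs)) (≤-trans (length-mono-≤ u⊆t) (≤-reflexive (length-t n)))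

corollary2 : ∃[ C ] ∃[ N ] ((n : ℕ) → N ≤ n →
    Σ ℕ (λ k → IsLCSLength (μ^ n (false ∷ [])) (μ^ n (true ∷ [])) k
    × k ≤ 2 ^ n × n * (2 ^ n ∸ k) ≤ C * 2 ^ n))
corollary2 = 16 , 0 , λ n _ →
  lcs (t n) (s n) , lcs-isLCS (t n) (s n) , lcs≤2^n n , lcs-defect (nearly-common n)
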